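{- Consider the following eight two-vertex Boolean networks $(f_1,f_2)$: $[1,01,10]$: $f_1=x_1\land\neg x_2,f_2=\neg x_1$; $[2,01,10]$: $f_1=x_1\land\neg x_2,f_2=\neg x_1\lor x_2$; $[3,01,10]$: $f_1=x_1,f_2=\neg x_1$; $[4,01,10]$: $f_1=\neg x_2,f_2=\neg x_1\land x_2$; $[5,01,10]$: $f_1=\neg x_2,f_2=x_2$; $[6,01,10]$: $f_1=x_1\lor\neg x_2,f_2=\neg x_1\land x_2$; $[8,01,10]$: $f_1=\neg x_2,f_2=\neg x_1\lor x_2$; $[9,01,10]$: $f_1=x_1\lor\neg x_2,f_2=\neg x_1$. For any delay vector $(\alpha,\beta)$, every MBN built on one of these networks has exactly two attractors, the fixed points $(0,\beta)$ and $(\alpha,0)$.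
   Context: The MBN built on a two-vertex Boolean network $(f_1,f_2)$ with delay vector $(\alpha,\beta)$ of positive integers has configurations $(\rho,\gamma)$ with $0\le\rho\le\alpha$, $0\le\gamma\le\beta$, underlying Boolean state $x=([\rho\ge1],[\gamma\ge1])$, and dynamics: the first coordinate becomes $\alpha$ if $f_1(x)=1$, else $\max(\rho-1,0)$; the second becomes $\beta$ if $f_2(x)=1$, else $\max(\gamma-1,0)$. Attractors are periodic orbits: fixed points (length 1) and limit cycles (length $\ge2$). -}

module Defs where

open import Data.Bool using (Bool; true; false; _∧_; _∨_; not; if_then_else_)
open import Data.Nat using (ℕ; zero; suc; pred; _≤_)
open import Data.Product using (_×_; _,_; proj₁; proj₂; ∃)
open import Relation.Binary.PropositionalEquality using (_≡_)

record BN2 : Set where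
  constructor bn
  field
    f₁ : Bool → Bool → Bool
    f₂ : Bool → Bool → Bool
open BN2 public

net1 net2 net3 net4 net5 net6 net8 net9 : BN2
net1 = bn (λ x₁ x₂ → x₁ ∧ not x₂)        (λ x₁ x₂ → not x₁)
net2 = bn (λ x₁ x₂ → x₁ ∧ not x₂)        (λ x₁ x₂ → not x₁ ∨ x₂)
net3 = bn (λ x₁ x₂ → x₁)                 (λ x₁ x₂ → not x₁)
net4 = bn (λ x₁ x₂ → not x₂)             (λ x₁ x₂ → not x₁ ∧ x₂)
net5 = bn (λ x₁ x₂ → not x₂)             (λ x₁ x₂ → x₂)
net6 = bn (λ x₁ x₂ → x₁ ∨ not x₂)        (λ x₁ x₂ → not x₁ ∧ x₂)
net8 = bn (λ x₁ x₂ → not x₂)             (λ x₁ x₂ → not x₁ ∨ x₂)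
net9 = bn (λ x₁ x₂ → x₁ ∨ not x₂)        (λ x₁ x₂ → not x₁)

data IsListedNet : BN2 → Set where
  is1 : IsListedNet net1
  is2 : IsListedNet net2
  is3 : IsListedNet net3
  is4 : IsListedNet net4
  is5 : IsListedNet net5
  is6 : IsListedNet net6
  is8 : IsListedNet net8
  is9 : IsListedNet net9

pos : ℕ → Bool
pos zero    = false
pos (suc _) = true

Config : Set
Config = ℕ × ℕ

ValidConfig : ℕ → ℕ → Config → Set
ValidConfig α β (ρ , γ) = ρ ≤ α × γ ≤ β

state : Config → Bool × Bool
state (ρ , γ) = pos ρ , pos γ

step : BN2 → ℕ → ℕ → Config → Config
step F α β (ρ , γ) =
  (if f₁ F (pos ρ) (pos γ) then α else pred ρ) ,
  (if f₂ F (pos ρ) (pos γ) then β else pred γ)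

iterate : (Config → Config) → ℕ → Config → Config
iterate g zero    c = c
iterate g (suc k) c = g (iterate g k c)

-- c lies on a periodic orbit (an attractor).
IsPeriodic : BN2 → ℕ → ℕ → Config → Set
IsPeriodic F α β c = ∃ λ k → iterate (step F α β) (suc k) c ≡ c

IsFixedPoint : BN2 → ℕ → ℕ → Config → Set
IsFixedPoint F α β c = step F α β c ≡ c

{-# OPTIONS --safe #-}
-- The eight networks are exactly those whose Boolean dynamics fixes 10 and 01, moves 00
-- and 11, and does not swap 00 and 11. For such a network every MBN configuration, valid
-- or not, reaches (0 , β) or (α , 0): off the origin an axis configuration jumps there in
-- one step; in the interior some counter keeps decaying until an axis is hit, and the
-- origin itself leaves either directly to a fixed point or to (α , β), which cannot decay
-- back to the origin. A periodic point that reaches a fixed point is that fixed point.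
module Submission where

open import Defs
open import Data.Bool using (Bool; true; false; if_then_else_)
open import Data.Nat using (ℕ; zero; suc; pred; _≥_)
open import Data.Product using (_×_; _,_; ∃)
open import Data.Sum using (_⊎_; inj₁; inj₂)
open import Data.Empty using (⊥-elim)
open import Function using (_∘_)
open import Relation.Binary.PropositionalEquality
  using (_≡_; _≢_; refl; sym; trans; cong; subst; module ≡-Reasoning)

iterate-commute : ∀ (g : Config → Config) n c → iterate g n (g c) ≡ g (iterate g n c)
iterate-commute g zero    c = refl
iterate-commute g (suc n) c = cong g (iterate-commute g n c)

iterate-fixed : ∀ (g : Config → Config) {p} → g p ≡ p → ∀ n → iterate g n p ≡ p
iterate-fixed g gp≡p zero    = refl
iterate-fixed g gp≡p (suc n) = trans (cong g (iterate-fixed g gp≡p n)) gp≡p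

-- The successor of a periodic point is periodic, so induction on the time to reach p applies.
periodic-reaching-fixed : ∀ (g : Config → Config) {p c} k n → g p ≡ p →
  iterate g (suc k) c ≡ c → iterate g n c ≡ p → c ≡ p
periodic-reaching-fixed g k zero gp≡p periodic reach = reach
periodic-reaching-fixed g {p} {c} k (suc n) gp≡p periodic reach = begin
  c                      ≡⟨ sym periodic ⟩
  g (iterate g k c)      ≡⟨ sym (iterate-commute g k c) ⟩
  iterate g k (g c)      ≡⟨ cong (iterate g k) gc≡p ⟩
  iterate g k p          ≡⟨ iterate-fixed g gp≡p k ⟩
  p                      ∎
  where
  open ≡-Reasoning
  gc≡p : g c ≡ p
  gc≡p = periodic-reaching-fixed g k n gp≡p
    (trans (iterate-commute g (suc k) c) (cong g periodic))
    (trans (iterate-commute g n c) reach)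

bstep : BN2 → Bool × Bool → Bool × Bool
bstep F (x , y) = f₁ F x y , f₂ F x y

mbnUpdate : ℕ → ℕ → Bool × Bool → Config → Config
mbnUpdate α β (u , v) (ρ , γ) = (if u then α else pred ρ) , (if v then β else pred γ)

record Bistable (F : BN2) : Set where
  field
    fixes-10   : bstep F (true , false) ≡ (true , false)
    fixes-01   : bstep F (false , true) ≡ (false , true)
    moves-00   : bstep F (false , false) ≢ (false , false)
    moves-11   : bstep F (true , true) ≢ (true , true)
    no-2-cycle : bstep F (true , true) ≡ (false , false) → bstep F (false , false) ≢ (true , true)

listed-bistable : ∀ {F} → IsListedNet F → Bistable F
listed-bistable is1 = record { fixes-10 = refl ; fixes-01 = refl ; moves-00 = λ () ; moves-11 = λ () ; no-2-cycle = λ _ () }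
listed-bistable is2 = record { fixes-10 = refl ; fixes-01 = refl ; moves-00 = λ () ; moves-11 = λ () ; no-2-cycle = λ () }
listed-bistable is3 = record { fixes-10 = refl ; fixes-01 = refl ; moves-00 = λ () ; moves-11 = λ () ; no-2-cycle = λ () }
listed-bistable is4 = record { fixes-10 = refl ; fixes-01 = refl ; moves-00 = λ () ; moves-11 = λ () ; no-2-cycle = λ _ () }
listed-bistable is5 = record { fixes-10 = refl ; fixes-01 = refl ; moves-00 = λ () ; moves-11 = λ () ; no-2-cycle = λ () }
listed-bistable is6 = record { fixes-10 = refl ; fixes-01 = refl ; moves-00 = λ () ; moves-11 = λ () ; no-2-cycle = λ () }
listed-bistable is8 = record { fixes-10 = refl ; fixes-01 = refl ; moves-00 = λ () ; moves-11 = λ () ; no-2-cycle = λ () }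
listed-bistable is9 = record { fixes-10 = refl ; fixes-01 = refl ; moves-00 = λ () ; moves-11 = λ () ; no-2-cycle = λ () }

module BistableMBN {F : BN2} (bistable : Bistable F) (a b : ℕ) where
  open Bistable bistable

  α β : ℕ
  α = suc a
  β = suc b

  Target : Config → Set
  Target c = c ≡ (0 , β) ⊎ c ≡ (α , 0)

  Reaches : Config → Set
  Reaches c = ∃ λ n → Target (iterate (step F α β) n c)

  step-by : ∀ {c s} → bstep F (state c) ≡ s → step F α β c ≡ mbnUpdate α β s c
  step-by {c} = cong (λ s → mbnUpdate α β s c)

  fixed-0β : IsFixedPoint F α β (0 , β)
  fixed-0β = step-by fixes-01

  fixed-α0 : IsFixedPoint F α β (α , 0)
  fixed-α0 = step-by fixes-10

  reaches-target : ∀ {c} → Target c → Reaches c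
  reaches-target t = 0 , t

  reaches-by : ∀ {c s} → bstep F (state c) ≡ s → Reaches (mbnUpdate α β s c) → Reaches c
  reaches-by {c} e (n , t) =
    suc n , subst Target (trans (cong (iterate (step F α β) n) (sym (step-by e)))
                                (iterate-commute (step F α β) n c)) t

  reaches-axis₁ : ∀ ρ → Reaches (suc ρ , 0)
  reaches-axis₁ ρ = reaches-by fixes-10 (reaches-target (inj₂ refl))

  reaches-axis₂ : ∀ γ → Reaches (0 , suc γ)
  reaches-axis₂ γ = reaches-by fixes-01 (reaches-target (inj₁ refl))

  reaches-resetting₁ : bstep F (true , true) ≡ (true , false) → ∀ ρ γ → Reaches (suc ρ , suc γ)
  reaches-resetting₁ e ρ zero    = reaches-by e (reaches-axis₁ a)
  reaches-resetting₁ e ρ (suc γ) = reaches-by e (reaches-resetting₁ e a γ)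

  reaches-resetting₂ : bstep F (true , true) ≡ (false , true) → ∀ ρ γ → Reaches (suc ρ , suc γ)
  reaches-resetting₂ e zero    γ = reaches-by e (reaches-axis₂ b)
  reaches-resetting₂ e (suc ρ) γ = reaches-by e (reaches-resetting₂ e ρ b)

  reaches-decaying : bstep F (true , true) ≡ (false , false) → Reaches (0 , 0) →
    ∀ ρ γ → Reaches (suc ρ , suc γ)
  reaches-decaying e origin zero    zero    = reaches-by e origin
  reaches-decaying e origin zero    (suc γ) = reaches-by e (reaches-axis₂ γ)
  reaches-decaying e origin (suc ρ) zero    = reaches-by e (reaches-axis₁ ρ)
  reaches-decaying e origin (suc ρ) (suc γ) = reaches-by e (reaches-decaying e origin ρ γ)

  -- The premise is needed only when 00 jumps to 11; taking it as an argument breaks the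
  -- circularity between the origin and the interior.
  reaches-origin : (bstep F (false , false) ≡ (true , true) → Reaches (α , β)) → Reaches (0 , 0)
  reaches-origin from-αβ with bstep F (false , false) in e
  ... | false , false = ⊥-elim (moves-00 e)
  ... | false , true  = reaches-by e (reaches-target (inj₁ refl))
  ... | true  , false = reaches-by e (reaches-target (inj₂ refl))
  ... | true  , true  = reaches-by e (from-αβ refl)

  reaches-interior : ∀ ρ γ → Reaches (suc ρ , suc γ)
  reaches-interior with bstep F (true , true) in e
  ... | true  , true  = ⊥-elim (moves-11 e)
  ... | true  , false = reaches-resetting₁ e
  ... | false , true  = reaches-resetting₂ e
  ... | false , false = reaches-decaying e (reaches-origin (⊥-elim ∘ no-2-cycle e))

  reaches : ∀ c → Reaches c
  reaches (zero  , zero)  = reaches-origin (λ _ → reaches-interior a b)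
  reaches (zero  , suc γ) = reaches-axis₂ γ
  reaches (suc ρ , zero)  = reaches-axis₁ ρ
  reaches (suc ρ , suc γ) = reaches-interior ρ γ

  periodic⇒target : ∀ c → IsPeriodic F α β c → Target c
  periodic⇒target c (k , periodic) with reaches c
  ... | n , inj₁ t = inj₁ (periodic-reaching-fixed (step F α β) k n fixed-0β periodic t)
  ... | n , inj₂ t = inj₂ (periodic-reaching-fixed (step F α β) k n fixed-α0 periodic t)

proposition14 : (F : BN2) → IsListedNet F → (α β : ℕ) → α ≥ 1 → β ≥ 1 →
    IsFixedPoint F α β (0 , β) × IsFixedPoint F α β (α , 0) ×
    ((c : Config) → ValidConfig α β c → IsPeriodic F α β c →
      c ≡ (0 , β) ⊎ c ≡ (α , 0))
proposition14 F listed (suc a) (suc b) _ _ =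
  fixed-0β , fixed-α0 , λ c _ → periodic⇒target c
  where open BistableMBN (listed-bistable listed) a b
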